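{- Let $q=2^{2k+1}$ for some positive integer $k$. Then there exists an irregular orthomorphism over $\mathbb{F}_q$.
   Context: Let $\mathbb{F}_q$ be the finite field of order $q$. An orthomorphism is a permutation $\theta$ of $\mathbb{F}_q$ such that $x\mapsto\theta(x)-x$ is also a permutation. For $k\mid(q-1)$, fix a generator $g$ of $\mathbb{F}_q^*$ and let $C_{k,i}=\{g^j: j\equiv i\pmod k\}$, $0\le i<k$. A cyclotomic map of index $k$ with multipliers $[a_0,\dots,a_{k-1}]$ is $\theta(0)=0$, $\theta(x)=a_ix$ for $x\in C_{k,i}$. $\mathscr{C}_k(q)$ is the set of orthomorphisms that are cyclotomic maps of index $k$, and $\mathscr{D}_k(q)=\mathscr{C}_k(q)\setminus\bigcup_{\ell<k,\ \ell\mid(q-1)}\mathscr{C}_\ell(q)$. An orthomorphism in $\mathscr{D}_{q-1}(q)$ is called non-cyclotomic. For an orthomorphism $\theta$ and $h\in\mathbb{F}_q$, the translation $T_h[\theta]$ is the orthomorphism $x\mapsto\theta(x+h)-\theta(h)$. An orthomorphism $\theta$ is irregular if $T_h[\theta]$ is non-cyclotomic for every $h\in\mathbb{F}_q$. -}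

module Defs where

open import Level using (Level) renaming (suc to lsuc)
open import Data.Nat using (ℕ; zero; suc; _∸_; _<_; NonZero) renaming (_+_ to _+ℕ_; _*_ to _*ℕ_)
open import Data.Nat.Divisibility using (_∣_)
open import Data.Nat.DivMod using (_mod_)
open import Data.Fin using (Fin)
open import Data.Product using (Σ; ∃; _×_)
open import Relation.Binary.PropositionalEquality using (_≡_; _≢_)
open import Relation.Nullary using (¬_)
open import Algebra.Structures using (IsCommutativeRing)
open import Function.Definitions using (Bijective)
open import Function.Bundles using (_↔_)

record Field (c : Level) : Set (lsuc c) where
  infixl 7 _*_
  infixl 6 _+_ _-_
  field
    Carrier : Set c
    _+_ _*_ : Carrier → Carrier → Carrier
    -_      : Carrier → Carrier
    0# 1#   : Carrier
    isCommutativeRing : IsCommutativeRing _≡_ _+_ _*_ -_ 0# 1#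
    0≢1     : 0# ≢ 1#
    inverse : ∀ x → x ≢ 0# → Σ Carrier (λ y → x * y ≡ 1#)

  _-_ : Carrier → Carrier → Carrier
  x - y = x + (- y)

  _^_ : Carrier → ℕ → Carrier
  x ^ zero  = 1#
  x ^ suc n = x * (x ^ n)

HasOrder : ∀ {c} → Field c → ℕ → Set c
HasOrder F q = Field.Carrier F ↔ Fin q

module _ {c} (F : Field c) where
  open Field F

  IsGenerator : Carrier → Set c
  IsGenerator g = g ≢ 0# × (∀ x → x ≢ 0# → ∃ λ (j : ℕ) → g ^ j ≡ x)

  IsOrthomorphism : (Carrier → Carrier) → Set c
  IsOrthomorphism θ = Bijective _≡_ _≡_ θ × Bijective _≡_ _≡_ (λ x → θ x - x)

  T : Carrier → (Carrier → Carrier) → (Carrier → Carrier)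
  T h θ x = θ (x + h) - θ h

  -- θ is a cyclotomic map of index ℓ w.r.t. generator g:
  -- θ(0)=0 and θ(x) = a_i x for x ∈ C_{ℓ,i} = {g^j : j ≡ i mod ℓ}
  IsCyclotomicMap : (g : Carrier) (ℓ : ℕ) .{{_ : NonZero ℓ}} → (Carrier → Carrier) → Set c
  IsCyclotomicMap g ℓ θ =
    θ 0# ≡ 0# × ∃ λ (a : Fin ℓ → Carrier) → ∀ (j : ℕ) → θ (g ^ j) ≡ a (j mod ℓ) * (g ^ j)

  InC : (g : Carrier) (ℓ : ℕ) .{{_ : NonZero ℓ}} → (Carrier → Carrier) → Set c
  InC g ℓ θ = IsOrthomorphism θ × IsCyclotomicMap g ℓ θ

  NonCyclotomic : (q : ℕ) (g : Carrier) → (Carrier → Carrier) → Set c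
  NonCyclotomic q g θ =
    (∀ (nz : NonZero (q ∸ 1)) → InC g (q ∸ 1) {{nz}} θ)
    × (∀ (ℓ : ℕ) (nz : NonZero ℓ) → ℓ ∣ (q ∸ 1) → ℓ < q ∸ 1 → ¬ InC g ℓ {{nz}} θ)

  Irregular : (q : ℕ) (g : Carrier) → (Carrier → Carrier) → Set c
  Irregular q g θ = IsOrthomorphism θ × (∀ h → NonCyclotomic q g (T h θ))

-- Over F with |F| = 2ⁿ, n odd, let p = g² + g, r = p²(p + 1) and θ(x) = p x + Tr(r x), Tr the
-- absolute trace. θ is additive, so every translate T_h[θ] equals θ. It is an orthomorphism since
-- θ and θ - id have trivial kernels: a nonzero z in either kernel forces Tr(r z) = 1, while r z is
-- then p² + p resp. p², both of trace 0 because p = g² + g. Finally θ commutes with multiplication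
-- by no g^ℓ, 0 < ℓ < 2ⁿ - 1: at y = r⁻¹ this would give Tr(g^ℓ) = g^ℓ (as Tr 1 = 1 for n odd),
-- so g^ℓ ∈ {0, 1}. Hence no translate is cyclotomic of a smaller index, while each one, fixing 0,
-- is cyclotomic of index 2ⁿ - 1.
module Submission where

open import Defs
open import Level using (Level)
open import Data.Nat as ℕ using (ℕ; zero; suc; _∸_; NonZero)
import Data.Nat.Properties as ℕ
open import Data.Nat.DivMod using (_%_; _/_; _mod_; m≡m%n+[m/n]*n; m%n<n; [m+n]%n≡m%n)
open import Data.Fin as Fin using (Fin; toℕ; punchIn; punchOut)
import Data.Fin.Properties as Fin
open import Data.Product using (∃; _×_; _,_; proj₁; proj₂)
open import Data.Sum using (_⊎_; inj₁; inj₂)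
open import Relation.Nullary using (¬_; yes; no)
open import Relation.Binary.PropositionalEquality
open import Algebra.Bundles using (CommutativeRing)
open import Algebra.Structures using (IsCommutativeRing)
open import Function.Base using (_∘_)
open import Function.Definitions using (Injective; Surjective)
open import Function.Bundles using (Injection; Inverse)
open import Function.Properties.Inverse using (↔⇒↣; ↔-sym)
open import Relation.Binary.Definitions using (DecidableEquality)
open import Relation.Nullary.Decidable using (via-injection)
open import Data.Empty using (⊥-elim)
import Algebra.Morphism.Definitions as Morphism

module FieldProperties {c} (F : Field c) where
  open Field F
  open IsCommutativeRing isCommutativeRing public
    using ( +-assoc; +-comm; +-identityˡ; +-identityʳ; -‿inverseʳ
          ; *-assoc; *-comm; *-identityˡ; *-identityʳ; distribˡ; distribʳ; zeroˡ; zeroʳ)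

  commutativeRing : CommutativeRing c c
  commutativeRing = record { isCommutativeRing = isCommutativeRing }

  open CommutativeRing commutativeRing using (+-group; ring; commutativeSemiring)
  open import Algebra.Properties.Group +-group
    using (identityˡ-unique; x∙y⁻¹≈ε⇒x≈y; //-rightDividesˡ; //-rightDividesʳ)
  open import Algebra.Properties.Ring ring using (x[y-z]≈xy-xz)
  open import Algebra.Properties.CommutativeSemiring.Exp commutativeSemiring
    using (^-homo-*; ^-assocʳ) renaming (_^_ to _^ˢ_)

  x≢0⇒x*y≡0⇒y≡0 : ∀ {x y} → x ≢ 0# → x * y ≡ 0# → y ≡ 0#
  x≢0⇒x*y≡0⇒y≡0 {x} {y} x≢0 xy≡0 = begin
    y               ≡⟨ sym (*-identityˡ y) ⟩
    1# * y          ≡⟨ cong (_* y) (sym x⁻¹x≡1) ⟩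
    (x⁻¹ * x) * y   ≡⟨ *-assoc x⁻¹ x y ⟩
    x⁻¹ * (x * y)   ≡⟨ cong (x⁻¹ *_) xy≡0 ⟩
    x⁻¹ * 0#        ≡⟨ zeroʳ x⁻¹ ⟩
    0#              ∎
    where
    open ≡-Reasoning
    x⁻¹ = proj₁ (inverse x x≢0)
    x⁻¹x≡1 : x⁻¹ * x ≡ 1#
    x⁻¹x≡1 = trans (*-comm x⁻¹ x) (proj₂ (inverse x x≢0))

  *-nonZero : ∀ {x y} → x ≢ 0# → y ≢ 0# → x * y ≢ 0#
  *-nonZero x≢0 y≢0 xy≡0 = y≢0 (x≢0⇒x*y≡0⇒y≡0 x≢0 xy≡0)

  *-cancelˡ : ∀ {x y z} → x ≢ 0# → x * y ≡ x * z → y ≡ z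
  *-cancelˡ {x} {y} {z} x≢0 xy≡xz = x∙y⁻¹≈ε⇒x≈y y z (x≢0⇒x*y≡0⇒y≡0 x≢0 (begin
    x * (y - z)     ≡⟨ x[y-z]≈xy-xz x y z ⟩
    x * y - x * z   ≡⟨ cong (_- x * z) xy≡xz ⟩
    x * z - x * z   ≡⟨ -‿inverseʳ (x * z) ⟩
    0#              ∎))
    where open ≡-Reasoning

  x²≡x⇒x≡1 : ∀ {x} → x ≢ 0# → x ^ 2 ≡ x → x ≡ 1#
  x²≡x⇒x≡1 {x} x≢0 x²≡x = x∙y⁻¹≈ε⇒x≈y x 1# (x≢0⇒x*y≡0⇒y≡0 x≢0 (begin
    x * (x - 1#)     ≡⟨ x[y-z]≈xy-xz x x 1# ⟩
    x * x - x * 1#   ≡⟨ cong₂ _-_ (trans (cong (x *_) (sym (*-identityʳ x))) x²≡x) (*-identityʳ x) ⟩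
    x - x            ≡⟨ -‿inverseʳ x ⟩
    0#               ∎))
    where open ≡-Reasoning

  ^≡^ˢ : ∀ x n → x ^ n ≡ x ^ˢ n
  ^≡^ˢ x zero    = refl
  ^≡^ˢ x (suc n) = cong (x *_) (^≡^ˢ x n)

  ^-+ : ∀ x m n → x ^ (m ℕ.+ n) ≡ x ^ m * x ^ n
  ^-+ x m n rewrite ^≡^ˢ x (m ℕ.+ n) | ^≡^ˢ x m | ^≡^ˢ x n = ^-homo-* x m n

  ^-* : ∀ x m n → x ^ (m ℕ.* n) ≡ (x ^ m) ^ n
  ^-* x m n rewrite ^≡^ˢ (x ^ m) n | ^≡^ˢ x m | ^≡^ˢ x (m ℕ.* n) = sym (^-assocʳ x m n)

  1^n≡1 : ∀ n → 1# ^ n ≡ 1#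
  1^n≡1 zero    = refl
  1^n≡1 (suc n) = trans (*-identityˡ (1# ^ n)) (1^n≡1 n)

  ^-nonZero : ∀ {x} n → x ≢ 0# → x ^ n ≢ 0#
  ^-nonZero zero    x≢0 1≡0 = 0≢1 (sym 1≡0)
  ^-nonZero (suc n) x≢0     = *-nonZero x≢0 (^-nonZero n x≢0)

  ^-periodic : ∀ {x} d .{{_ : NonZero d}} → x ^ d ≡ 1# → ∀ j → x ^ j ≡ x ^ (j % d)
  ^-periodic {x} d xᵈ≡1 j = begin
    x ^ j                               ≡⟨ cong (x ^_) (m≡m%n+[m/n]*n j d) ⟩
    x ^ (j % d ℕ.+ (j / d) ℕ.* d)       ≡⟨ ^-+ x (j % d) _ ⟩
    x ^ (j % d) * x ^ ((j / d) ℕ.* d)   ≡⟨ cong (λ e → x ^ (j % d) * x ^ e) (ℕ.*-comm (j / d) d) ⟩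
    x ^ (j % d) * x ^ (d ℕ.* (j / d))   ≡⟨ cong (x ^ (j % d) *_) (^-* x d (j / d)) ⟩
    x ^ (j % d) * (x ^ d) ^ (j / d)     ≡⟨ cong (λ y → x ^ (j % d) * y ^ (j / d)) xᵈ≡1 ⟩
    x ^ (j % d) * 1# ^ (j / d)          ≡⟨ cong (x ^ (j % d) *_) (1^n≡1 (j / d)) ⟩
    x ^ (j % d) * 1#                    ≡⟨ *-identityʳ _ ⟩
    x ^ (j % d)                         ∎
    where open ≡-Reasoning

  Additive : (Carrier → Carrier) → Set c
  Additive f = Morphism.Homomorphic₂ Carrier Carrier _≡_ f _+_ _+_

  additive⇒0↦0 : ∀ {f} → Additive f → f 0# ≡ 0#
  additive⇒0↦0 {f} f-+ = identityˡ-unique (f 0#) (f 0#) (begin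
    f 0# + f 0#   ≡⟨ sym (f-+ 0# 0#) ⟩
    f (0# + 0#)   ≡⟨ cong f (+-identityˡ 0#) ⟩
    f 0#          ∎)
    where open ≡-Reasoning

  additive⇒translation-invariant : ∀ {θ} → Additive θ → ∀ h x → T F h θ x ≡ θ x
  additive⇒translation-invariant {θ} θ-+ h x = begin
    θ (x + h) - θ h     ≡⟨ cong (_- θ h) (θ-+ x h) ⟩
    (θ x + θ h) - θ h   ≡⟨ //-rightDividesʳ (θ h) (θ x) ⟩
    θ x                 ∎
    where open ≡-Reasoning

  additive∧trivialKernel⇒injective : ∀ {f} → Additive f → (∀ x → f x ≡ 0# → x ≡ 0#) → Injective _≡_ _≡_ f
  additive∧trivialKernel⇒injective {f} f-+ ker {x} {y} fx≡fy =
    x∙y⁻¹≈ε⇒x≈y x y (ker (x - y) (identityˡ-unique (f (x - y)) (f y) (begin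
      f (x - y) + f y   ≡⟨ sym (f-+ (x - y) y) ⟩
      f ((x - y) + y)   ≡⟨ cong f (//-rightDividesˡ y x) ⟩
      f x               ≡⟨ fx≡fy ⟩
      f y               ∎)))
    where open ≡-Reasoning

  orthomorphism-resp-≗ : ∀ {θ φ} → θ ≗ φ → IsOrthomorphism F θ → IsOrthomorphism F φ
  orthomorphism-resp-≗ {θ} {φ} θ≗φ ((θ-inj , θ-surj) , (θ-id-inj , θ-id-surj)) =
    (resp-injective θ≗φ θ-inj , resp-surjective θ≗φ θ-surj) ,
    (resp-injective θ-id≗φ-id θ-id-inj , resp-surjective θ-id≗φ-id θ-id-surj)
    where
    θ-id≗φ-id : (λ x → θ x - x) ≗ (λ x → φ x - x)
    θ-id≗φ-id x = cong (_- x) (θ≗φ x)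
    resp-injective : ∀ {f f′ : Carrier → Carrier} → f ≗ f′ → Injective _≡_ _≡_ f → Injective _≡_ _≡_ f′
    resp-injective f≗f′ f-inj eq = f-inj (trans (f≗f′ _) (trans eq (sym (f≗f′ _))))
    resp-surjective : ∀ {f f′ : Carrier → Carrier} → f ≗ f′ → Surjective _≡_ _≡_ f → Surjective _≡_ _≡_ f′
    resp-surjective f≗f′ f-surj y = proj₁ (f-surj y) , λ { refl → trans (sym (f≗f′ _)) (proj₂ (f-surj y) refl) }

  ScalingEquivariant : Carrier → (Carrier → Carrier) → Set c
  ScalingEquivariant ζ θ = ∀ {y} → y ≢ 0# → θ (y * ζ) ≡ θ y * ζ

  scalingEquivariant-resp-≗ : ∀ {ζ θ φ} → θ ≗ φ → ScalingEquivariant ζ θ → ScalingEquivariant ζ φ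
  scalingEquivariant-resp-≗ {ζ} θ≗φ θ-eqv y≢0 = trans (sym (θ≗φ _)) (trans (θ-eqv y≢0) (cong (_* ζ) (θ≗φ _)))

  module _ {g : Carrier} (g≢0 : g ≢ 0#) where

    zero-fixing⇒cyclotomic : ∀ d .{{_ : NonZero d}} → g ^ d ≡ 1# →
                             ∀ {θ} → θ 0# ≡ 0# → IsCyclotomicMap F g d θ
    zero-fixing⇒cyclotomic d gᵈ≡1 {θ} θ0≡0 = θ0≡0 , a , θgʲ≡a*gʲ
      where
      gⁱ⁻¹ : Fin d → Carrier
      gⁱ⁻¹ i = proj₁ (inverse (g ^ toℕ i) (^-nonZero (toℕ i) g≢0))
      a : Fin d → Carrier
      a i = θ (g ^ toℕ i) * gⁱ⁻¹ i
      a-spec : ∀ i → a i * g ^ toℕ i ≡ θ (g ^ toℕ i)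
      a-spec i = begin
        (θ (g ^ toℕ i) * gⁱ⁻¹ i) * g ^ toℕ i   ≡⟨ *-assoc _ _ _ ⟩
        θ (g ^ toℕ i) * (gⁱ⁻¹ i * g ^ toℕ i)   ≡⟨ cong (θ (g ^ toℕ i) *_) (trans (*-comm _ _) gⁱgⁱ⁻¹≡1) ⟩
        θ (g ^ toℕ i) * 1#                     ≡⟨ *-identityʳ _ ⟩
        θ (g ^ toℕ i)                          ∎
        where
        open ≡-Reasoning
        gⁱgⁱ⁻¹≡1 = proj₂ (inverse (g ^ toℕ i) (^-nonZero (toℕ i) g≢0))
      θgʲ≡a*gʲ : ∀ j → θ (g ^ j) ≡ a (j mod d) * g ^ j
      θgʲ≡a*gʲ j = begin
        θ (g ^ j)                         ≡⟨ cong θ gʲ≡gⁱ ⟩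
        θ (g ^ toℕ (j mod d))             ≡⟨ sym (a-spec (j mod d)) ⟩
        a (j mod d) * g ^ toℕ (j mod d)   ≡⟨ cong (a (j mod d) *_) (sym gʲ≡gⁱ) ⟩
        a (j mod d) * g ^ j               ∎
        where
        open ≡-Reasoning
        gʲ≡gⁱ : g ^ j ≡ g ^ toℕ (j mod d)
        gʲ≡gⁱ = trans (^-periodic d gᵈ≡1 j) (cong (g ^_) (sym (Fin.toℕ-fromℕ< (m%n<n j d))))

  cyclotomic⇒equivariant : ∀ {g} → IsGenerator F g → ∀ {ℓ} .{{_ : NonZero ℓ}} {θ} → IsCyclotomicMap F g ℓ θ →
                           ScalingEquivariant (g ^ ℓ) θ
  cyclotomic⇒equivariant {g} (_ , powers) {ℓ} {θ} (_ , a , θgʲ≡a*gʲ) {y} y≢0 with powers y y≢0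
  ... | j , refl = begin
    θ (g ^ j * g ^ ℓ)                     ≡⟨ cong θ (sym (^-+ g j ℓ)) ⟩
    θ (g ^ (j ℕ.+ ℓ))                     ≡⟨ θgʲ≡a*gʲ (j ℕ.+ ℓ) ⟩
    a ((j ℕ.+ ℓ) mod ℓ) * g ^ (j ℕ.+ ℓ)   ≡⟨ cong₂ _*_ (cong a [j+ℓ]modℓ≡jmodℓ) (^-+ g j ℓ) ⟩
    a (j mod ℓ) * (g ^ j * g ^ ℓ)         ≡⟨ sym (*-assoc _ _ _) ⟩
    (a (j mod ℓ) * g ^ j) * g ^ ℓ         ≡⟨ cong (_* g ^ ℓ) (sym (θgʲ≡a*gʲ j)) ⟩
    θ (g ^ j) * g ^ ℓ                     ∎
    where
    open ≡-Reasoning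
    [j+ℓ]modℓ≡jmodℓ : (j ℕ.+ ℓ) mod ℓ ≡ j mod ℓ
    [j+ℓ]modℓ≡jmodℓ = Fin.fromℕ<-cong _ _ ([m+n]%n≡m%n j ℓ) _ _

module FiniteField {c} (F : Field c) (N : ℕ) (hord : HasOrder F (suc N)) where
  open Field F
  open FieldProperties F

  private
    toFin : Carrier → Fin (suc N)
    toFin = Injection.to (↔⇒↣ hord)
    toFin-injective : Injective _≡_ _≡_ toFin
    toFin-injective = Injection.injective (↔⇒↣ hord)
    fromFin : Fin (suc N) → Carrier
    fromFin = Injection.to (↔⇒↣ (↔-sym hord))
    fromFin-injective : Injective _≡_ _≡_ fromFin
    fromFin-injective = Injection.injective (↔⇒↣ (↔-sym hord))
    toFin∘fromFin : ∀ i → toFin (fromFin i) ≡ i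
    toFin∘fromFin = Inverse.strictlyInverseˡ hord

  _≟_ : DecidableEquality Carrier
  _≟_ = via-injection (↔⇒↣ hord) Fin._≟_

  injective⇒surjective : ∀ {f : Carrier → Carrier} → Injective _≡_ _≡_ f → Surjective _≡_ _≡_ f
  injective⇒surjective {f} f-injective y
    with Fin.any? (λ i → toFin (f (fromFin i)) Fin.≟ toFin y)
  ... | yes (i , f[i]≡y) = fromFin i , λ { refl → toFin-injective f[i]≡y }
  ... | no y∉image = ⊥-elim (ℕ.1+n≰n (Fin.injective⇒≤ {f = skipY} skipY-injective))
    where
    skipY : Fin (suc N) → Fin N
    skipY i = punchOut {i = toFin y} {j = toFin (f (fromFin i))} (λ y≡f[i] → y∉image (i , sym y≡f[i]))
    skipY-injective : Injective _≡_ _≡_ skipY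
    skipY-injective eq = fromFin-injective (f-injective (toFin-injective (Fin.punchOut-injective {i = toFin y} _ _ eq)))

  injective⇒orthomorphism : ∀ {θ} → Injective _≡_ _≡_ θ → Injective _≡_ _≡_ (λ x → θ x - x) →
                            IsOrthomorphism F θ
  injective⇒orthomorphism θ-injective θ-id-injective =
    (θ-injective , injective⇒surjective θ-injective) , (θ-id-injective , injective⇒surjective θ-id-injective)

  x≢0⇒∃[d]xᵈ≡1 : ∀ {x} → x ≢ 0# → ∃ λ d → 0 ℕ.< d × d ℕ.≤ N × x ^ d ≡ 1#
  x≢0⇒∃[d]xᵈ≡1 {x} x≢0 with Fin.pigeonhole (ℕ.n<1+n N) skip0
    where
    skip0 : Fin (suc N) → Fin N
    skip0 i = punchOut {i = toFin 0#} {j = toFin (x ^ toℕ i)} (λ 0≡xⁱ → ^-nonZero (toℕ i) x≢0 (toFin-injective (sym 0≡xⁱ)))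
  ... | i , j , i<j , eq =
    toℕ j ∸ toℕ i , ℕ.m<n⇒0<n∸m i<j , ℕ.≤-trans (ℕ.m∸n≤m (toℕ j) (toℕ i)) (ℕ.≤-pred (Fin.toℕ<n j)) ,
    sym (*-cancelˡ (^-nonZero (toℕ i) x≢0) (begin
      x ^ toℕ i * 1#                    ≡⟨ *-identityʳ _ ⟩
      x ^ toℕ i                         ≡⟨ toFin-injective (Fin.punchOut-injective {i = toFin 0#} _ _ eq) ⟩
      x ^ toℕ j                         ≡⟨ cong (x ^_) (sym (ℕ.m+[n∸m]≡n (ℕ.<⇒≤ i<j))) ⟩
      x ^ (toℕ i ℕ.+ (toℕ j ∸ toℕ i))   ≡⟨ ^-+ x (toℕ i) _ ⟩
      x ^ toℕ i * x ^ (toℕ j ∸ toℕ i)   ∎))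
    where open ≡-Reasoning

  module _ {g : Carrier} (gen : IsGenerator F g) where

    gᵈ≡1⇒N≤d : ∀ d .{{_ : NonZero d}} → g ^ d ≡ 1# → N ℕ.≤ d
    gᵈ≡1⇒N≤d d gᵈ≡1 = Fin.injective⇒≤ {f = log} log-injective
      where
      nonZeroElement : Fin N → Carrier
      nonZeroElement i = fromFin (punchIn (toFin 0#) i)
      nonZeroElement≢0 : ∀ i → nonZeroElement i ≢ 0#
      nonZeroElement≢0 i eq = Fin.punchInᵢ≢i (toFin 0#) i (trans (sym (toFin∘fromFin _)) (cong toFin eq))
      log : Fin N → Fin d
      log i = proj₁ (proj₂ gen _ (nonZeroElement≢0 i)) mod d
      log-spec : ∀ i → g ^ toℕ (log i) ≡ nonZeroElement i
      log-spec i = begin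
        g ^ toℕ (j mod d)   ≡⟨ cong (g ^_) (Fin.toℕ-fromℕ< (m%n<n j d)) ⟩
        g ^ (j % d)         ≡⟨ sym (^-periodic d gᵈ≡1 j) ⟩
        g ^ j               ≡⟨ proj₂ (proj₂ gen _ (nonZeroElement≢0 i)) ⟩
        nonZeroElement i    ∎
        where
        open ≡-Reasoning
        j = proj₁ (proj₂ gen _ (nonZeroElement≢0 i))
      log-injective : Injective _≡_ _≡_ log
      log-injective {i} {i'} eq = Fin.punchIn-injective (toFin 0#) i i' (fromFin-injective (begin
        nonZeroElement i    ≡⟨ sym (log-spec i) ⟩
        g ^ toℕ (log i)     ≡⟨ cong (λ k → g ^ toℕ k) eq ⟩
        g ^ toℕ (log i')    ≡⟨ log-spec i' ⟩
        nonZeroElement i'   ∎))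
        where open ≡-Reasoning

    gᴺ≡1 : g ^ N ≡ 1#
    gᴺ≡1 with x≢0⇒∃[d]xᵈ≡1 (proj₁ gen)
    ... | d , 0<d , d≤N , gᵈ≡1 = subst (λ e → g ^ e ≡ 1#) (ℕ.≤-antisym d≤N (gᵈ≡1⇒N≤d d {{ℕ.>-nonZero 0<d}} gᵈ≡1)) gᵈ≡1

    gˡ≢1 : ∀ ℓ .{{_ : NonZero ℓ}} → ℓ ℕ.< N → g ^ ℓ ≢ 1#
    gˡ≢1 ℓ ℓ<N gˡ≡1 = ℕ.<⇒≱ ℓ<N (gᵈ≡1⇒N≤d ℓ gˡ≡1)

    xᴺ≡1 : ∀ {x} → x ≢ 0# → x ^ N ≡ 1#
    xᴺ≡1 {x} x≢0 with proj₂ gen x x≢0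
    ... | j , refl = begin
      (g ^ j) ^ N     ≡⟨ sym (^-* g j N) ⟩
      g ^ (j ℕ.* N)   ≡⟨ cong (g ^_) (ℕ.*-comm j N) ⟩
      g ^ (N ℕ.* j)   ≡⟨ ^-* g N j ⟩
      (g ^ N) ^ j     ≡⟨ cong (_^ j) gᴺ≡1 ⟩
      1# ^ j          ≡⟨ 1^n≡1 j ⟩
      1#              ∎
      where open ≡-Reasoning

    x^[1+N]≡x : ∀ x → x ^ suc N ≡ x
    x^[1+N]≡x x with x ≟ 0#
    ... | yes refl = zeroˡ _
    ... | no x≢0   = trans (cong (x *_) (xᴺ≡1 x≢0)) (*-identityʳ x)

    nonCyclotomic : ∀ {θ} → IsOrthomorphism F θ → θ 0# ≡ 0# →
                    (∀ ℓ .{{_ : NonZero ℓ}} → ℓ ℕ.< N → ¬ ScalingEquivariant (g ^ ℓ) θ) →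
                    NonCyclotomic F (suc N) g θ
    nonCyclotomic {θ} θ-orth θ0≡0 not-equivariant =
      (λ nz → θ-orth , zero-fixing⇒cyclotomic (proj₁ gen) N {{nz}} gᴺ≡1 {θ} θ0≡0) ,
      (λ ℓ nz _ ℓ<N (_ , θ-cyclotomic) → not-equivariant ℓ {{nz}} ℓ<N (cyclotomic⇒equivariant gen {{nz}} θ-cyclotomic))

module CharacteristicTwo {c} (F : Field c) (_≟_ : DecidableEquality (Field.Carrier F))
                         (m : ℕ) (x^2^[1+m]≡x : ∀ x → Field._^_ F x (2 ℕ.^ suc m) ≡ x) where
  open Field F
  open FieldProperties F
  open CommutativeRing commutativeRing using (+-group; +-commutativeSemigroup; commutativeSemiring)
  open import Algebra.Properties.Group +-group using (inverseˡ-unique; ⁻¹-involutive; ∙-cancelˡ)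
  open import Algebra.Properties.CommutativeSemigroup +-commutativeSemigroup using () renaming (interchange to +-interchange)
  open import Algebra.Properties.Ring (CommutativeRing.ring commutativeRing) using (-1*x≈-x)
  open import Algebra.Solver.Ring.NaturalCoefficients.Default commutativeSemiring using (solve; _:=_; _:+_; _:*_; _:^_; con)

  -1≡1 : - 1# ≡ 1#
  -1≡1 = begin
    - 1#                       ≡⟨ sym (x^2^[1+m]≡x (- 1#)) ⟩
    (- 1#) ^ (2 ℕ.* 2 ℕ.^ m)   ≡⟨ ^-* (- 1#) 2 (2 ℕ.^ m) ⟩
    ((- 1#) ^ 2) ^ (2 ℕ.^ m)   ≡⟨ cong (_^ (2 ℕ.^ m)) [-1]²≡1 ⟩
    1# ^ (2 ℕ.^ m)             ≡⟨ 1^n≡1 (2 ℕ.^ m) ⟩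
    1#                         ∎
    where
    open ≡-Reasoning
    [-1]²≡1 : (- 1#) ^ 2 ≡ 1#
    [-1]²≡1 = begin
      - 1# * (- 1# * 1#)   ≡⟨ cong (- 1# *_) (*-identityʳ (- 1#)) ⟩
      - 1# * - 1#          ≡⟨ -1*x≈-x (- 1#) ⟩
      - - 1#               ≡⟨ ⁻¹-involutive 1# ⟩
      1#                   ∎

  -x≡x : ∀ x → - x ≡ x
  -x≡x x = begin
    - x        ≡⟨ sym (-1*x≈-x x) ⟩
    - 1# * x   ≡⟨ cong (_* x) -1≡1 ⟩
    1# * x     ≡⟨ *-identityˡ x ⟩
    x          ∎
    where open ≡-Reasoning

  x+x≡0 : ∀ x → x + x ≡ 0#
  x+x≡0 x = trans (cong (x +_) (sym (-x≡x x))) (-‿inverseʳ x)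

  x+y≡0⇒x≡y : ∀ {x y} → x + y ≡ 0# → x ≡ y
  x+y≡0⇒x≡y {x} {y} x+y≡0 = trans (inverseˡ-unique x y x+y≡0) (-x≡x y)

  ^2-additive : Additive (_^ 2)
  ^2-additive x y = begin
    (x + y) ^ 2                         ≡⟨ [x+y]²≡x²+y²+[xy+xy] x y ⟩
    (x ^ 2 + y ^ 2) + (x * y + x * y)   ≡⟨ cong (x ^ 2 + y ^ 2 +_) (x+x≡0 (x * y)) ⟩
    (x ^ 2 + y ^ 2) + 0#                ≡⟨ +-identityʳ _ ⟩
    x ^ 2 + y ^ 2                       ∎
    where
    open ≡-Reasoning
    [x+y]²≡x²+y²+[xy+xy] : ∀ x y → (x + y) ^ 2 ≡ (x ^ 2 + y ^ 2) + (x * y + x * y)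
    [x+y]²≡x²+y²+[xy+xy] = solve 2 (λ x y → (x :+ y) :^ 2 := (x :^ 2 :+ y :^ 2) :+ (x :* y :+ x :* y)) refl

  partialTrace : ℕ → Carrier → Carrier
  partialTrace zero    x = 0#
  partialTrace (suc i) x = x + partialTrace i (x ^ 2)

  partialTrace-additive : ∀ i → Additive (partialTrace i)
  partialTrace-additive zero    x y = sym (+-identityʳ 0#)
  partialTrace-additive (suc i) x y = begin
    (x + y) + partialTrace i ((x + y) ^ 2)                        ≡⟨ cong (λ z → (x + y) + partialTrace i z) (^2-additive x y) ⟩
    (x + y) + partialTrace i (x ^ 2 + y ^ 2)                      ≡⟨ cong ((x + y) +_) (partialTrace-additive i (x ^ 2) (y ^ 2)) ⟩
    (x + y) + (partialTrace i (x ^ 2) + partialTrace i (y ^ 2))   ≡⟨ +-interchange x y _ _ ⟩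
    (x + partialTrace i (x ^ 2)) + (y + partialTrace i (y ^ 2))   ∎
    where open ≡-Reasoning

  partialTrace-^2 : ∀ i x → partialTrace i x ^ 2 ≡ partialTrace i (x ^ 2)
  partialTrace-^2 zero    x = zeroˡ _
  partialTrace-^2 (suc i) x = trans (^2-additive x (partialTrace i (x ^ 2))) (cong (x ^ 2 +_) (partialTrace-^2 i (x ^ 2)))

  partialTrace-shift : ∀ i x → x + partialTrace i (x ^ 2) ≡ partialTrace i x + x ^ (2 ℕ.^ i)
  partialTrace-shift zero    x = trans (+-comm x 0#) (cong (0# +_) (sym (*-identityʳ x)))
  partialTrace-shift (suc i) x = begin
    x + ((x ^ 2) + partialTrace i ((x ^ 2) ^ 2))         ≡⟨ cong (x +_) (partialTrace-shift i (x ^ 2)) ⟩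
    x + (partialTrace i (x ^ 2) + (x ^ 2) ^ (2 ℕ.^ i))   ≡⟨ sym (+-assoc x _ _) ⟩
    (x + partialTrace i (x ^ 2)) + (x ^ 2) ^ (2 ℕ.^ i)   ≡⟨ cong ((x + partialTrace i (x ^ 2)) +_) (sym (^-* x 2 (2 ℕ.^ i))) ⟩
    (x + partialTrace i (x ^ 2)) + x ^ (2 ℕ.^ suc i)     ∎
    where open ≡-Reasoning

  partialTrace-odd-1 : ∀ j → partialTrace (suc (j ℕ.+ j)) 1# ≡ 1#
  partialTrace-odd-1 zero    = +-identityʳ 1#
  partialTrace-odd-1 (suc j) = begin
    partialTrace (suc (suc j ℕ.+ suc j)) 1#       ≡⟨ cong (λ i → partialTrace (suc (suc i)) 1#) (ℕ.+-suc j j) ⟩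
    partialTrace (suc (suc (suc (j ℕ.+ j)))) 1#   ≡⟨ partialTrace-suc-1 (suc (suc (j ℕ.+ j))) ⟩
    1# + partialTrace (suc (suc (j ℕ.+ j))) 1#    ≡⟨ cong (1# +_) (partialTrace-suc-1 (suc (j ℕ.+ j))) ⟩
    1# + (1# + partialTrace (suc (j ℕ.+ j)) 1#)   ≡⟨ sym (+-assoc 1# 1# _) ⟩
    (1# + 1#) + partialTrace (suc (j ℕ.+ j)) 1#   ≡⟨ cong (_+ partialTrace (suc (j ℕ.+ j)) 1#) (x+x≡0 1#) ⟩
    0# + partialTrace (suc (j ℕ.+ j)) 1#          ≡⟨ +-identityˡ _ ⟩
    partialTrace (suc (j ℕ.+ j)) 1#               ≡⟨ partialTrace-odd-1 j ⟩
    1#                                            ∎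
    where
    open ≡-Reasoning
    partialTrace-suc-1 : ∀ i → partialTrace (suc i) 1# ≡ 1# + partialTrace i 1#
    partialTrace-suc-1 i = cong (λ z → 1# + partialTrace i z) (1^n≡1 2)

  trace : Carrier → Carrier
  trace = partialTrace (suc m)

  trace-additive : Additive trace
  trace-additive = partialTrace-additive (suc m)

  trace-^2 : ∀ x → trace (x ^ 2) ≡ trace x
  trace-^2 x = ∙-cancelˡ x _ _ (begin
    x + trace (x ^ 2)             ≡⟨ partialTrace-shift (suc m) x ⟩
    trace x + x ^ (2 ℕ.^ suc m)   ≡⟨ cong (trace x +_) (x^2^[1+m]≡x x) ⟩
    trace x + x                   ≡⟨ +-comm (trace x) x ⟩
    x + trace x                   ∎)
    where open ≡-Reasoning

  trace-idempotent : ∀ x → trace x ^ 2 ≡ trace x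
  trace-idempotent x = trans (partialTrace-^2 (suc m) x) (trace-^2 x)

  trace-[x²+x]≡0 : ∀ x → trace (x ^ 2 + x) ≡ 0#
  trace-[x²+x]≡0 x = trans (trace-additive (x ^ 2) x) (trans (cong (_+ trace x) (trace-^2 x)) (x+x≡0 (trace x)))

  trace≡0⊎trace≡1 : ∀ x → trace x ≡ 0# ⊎ trace x ≡ 1#
  trace≡0⊎trace≡1 x with trace x ≟ 0#
  ... | yes tr≡0 = inj₁ tr≡0
  ... | no  tr≢0 = inj₂ (x²≡x⇒x≡1 tr≢0 (trace-idempotent x))

  traceMap : Carrier → Carrier → Carrier → Carrier
  traceMap a b x = a * x + trace (b * x)

  traceMap-additive : ∀ a b → Additive (traceMap a b)
  traceMap-additive a b x y = begin
    a * (x + y) + trace (b * (x + y))                   ≡⟨ cong₂ (λ u v → u + trace v) (distribˡ a x y) (distribˡ b x y) ⟩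
    (a * x + a * y) + trace (b * x + b * y)             ≡⟨ cong ((a * x + a * y) +_) (trace-additive (b * x) (b * y)) ⟩
    (a * x + a * y) + (trace (b * x) + trace (b * y))   ≡⟨ +-interchange (a * x) (a * y) _ _ ⟩
    traceMap a b x + traceMap a b y                     ∎
    where open ≡-Reasoning

  traceMap-trivialKernel : ∀ {a b} → a ≢ 0# → (∀ {z} → a * z ≡ 1# → trace (b * z) ≡ 0#) →
                           ∀ z → traceMap a b z ≡ 0# → z ≡ 0#
  traceMap-trivialKernel {a} {b} a≢0 az≡1⇒tr≡0 z z∈ker with trace≡0⊎trace≡1 (b * z)
  ... | inj₁ tr≡0 = x≢0⇒x*y≡0⇒y≡0 a≢0 (trans (x+y≡0⇒x≡y z∈ker) tr≡0)
  ... | inj₂ tr≡1 = ⊥-elim (0≢1 (trans (sym (az≡1⇒tr≡0 (trans (x+y≡0⇒x≡y z∈ker) tr≡1))) tr≡1))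

  traceMap-sub-id : ∀ a b x → traceMap a b x - x ≡ traceMap (a + 1#) b x
  traceMap-sub-id a b x = begin
    (a * x + trace (b * x)) - x    ≡⟨ cong ((a * x + trace (b * x)) +_) (-x≡x x) ⟩
    (a * x + trace (b * x)) + x    ≡⟨ [ax+t]+x≡[a+1]x+t a x (trace (b * x)) ⟩
    (a + 1#) * x + trace (b * x)   ∎
    where
    open ≡-Reasoning
    [ax+t]+x≡[a+1]x+t : ∀ a x t → (a * x + t) + x ≡ (a + 1#) * x + t
    [ax+t]+x≡[a+1]x+t = solve 3 (λ a x t → (a :* x :+ t) :+ x := (a :+ con 1) :* x :+ t) refl

  traceMap-equivariant⇒trace-fixed : ∀ {a b y ζ} → trace 1# ≡ 1# → b * y ≡ 1# →
                                     traceMap a b (y * ζ) ≡ traceMap a b y * ζ → trace ζ ≡ ζ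
  traceMap-equivariant⇒trace-fixed {a} {b} {y} {ζ} tr1≡1 by≡1 eqv = ∙-cancelˡ (a * (y * ζ)) _ _ (begin
    a * (y * ζ) + trace ζ         ≡⟨ cong (λ u → a * (y * ζ) + trace u) (sym byζ≡ζ) ⟩
    traceMap a b (y * ζ)          ≡⟨ eqv ⟩
    (a * y + trace (b * y)) * ζ   ≡⟨ cong (λ u → (a * y + trace u) * ζ) by≡1 ⟩
    (a * y + trace 1#) * ζ        ≡⟨ cong (λ u → (a * y + u) * ζ) tr1≡1 ⟩
    (a * y + 1#) * ζ              ≡⟨ distribʳ ζ (a * y) 1# ⟩
    (a * y) * ζ + 1# * ζ          ≡⟨ cong₂ _+_ (*-assoc a y ζ) (*-identityˡ ζ) ⟩
    a * (y * ζ) + ζ               ∎)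
    where
    open ≡-Reasoning
    byζ≡ζ : b * (y * ζ) ≡ ζ
    byζ≡ζ = trans (sym (*-assoc b y ζ)) (trans (cong (_* ζ) by≡1) (*-identityˡ ζ))

module IrregularConstruction {c} (F : Field c) (N : ℕ) (hord : HasOrder F (suc N))
                             {g : Field.Carrier F} (gen : IsGenerator F g)
                             (k : ℕ) (|F|≡2^[1+2k] : suc N ≡ 2 ℕ.^ suc (k ℕ.+ k)) (3<N : 3 ℕ.< N) where
  open Field F
  open FieldProperties F
  open FiniteField F N hord
  open CommutativeRing commutativeRing using (commutativeSemiring)
  open import Algebra.Solver.Ring.NaturalCoefficients.Default commutativeSemiring using (solve; _:=_; _:+_; _:*_; _:^_; con)

  x^2^[1+2k]≡x : ∀ x → x ^ (2 ℕ.^ suc (k ℕ.+ k)) ≡ x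
  x^2^[1+2k]≡x x = subst (λ e → x ^ e ≡ x) |F|≡2^[1+2k] (x^[1+N]≡x gen x)

  open CharacteristicTwo F _≟_ (k ℕ.+ k) x^2^[1+2k]≡x

  g≢0 : g ≢ 0#
  g≢0 = proj₁ gen

  g+1≢0 : g + 1# ≢ 0#
  g+1≢0 g+1≡0 = gˡ≢1 gen 1 (ℕ.<-trans (ℕ.s≤s (ℕ.s≤s ℕ.z≤n)) 3<N) (trans (*-identityʳ g) (x+y≡0⇒x≡y g+1≡0))

  p : Carrier
  p = g ^ 2 + g

  p≢0 : p ≢ 0#
  p≢0 = subst (_≢ 0#) (g[g+1]≡g²+g g) (*-nonZero g≢0 g+1≢0)
    where
    g[g+1]≡g²+g : ∀ g → g * (g + 1#) ≡ g ^ 2 + g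
    g[g+1]≡g²+g = solve 1 (λ g → g :* (g :+ con 1) := g :^ 2 :+ g) refl

  p+1≢0 : p + 1# ≢ 0#
  p+1≢0 p+1≡0 = gˡ≢1 gen 3 3<N (x+y≡0⇒x≡y (begin
    g ^ 3 + 1#                                   ≡⟨ sym (+-identityʳ _) ⟩
    (g ^ 3 + 1#) + 0#                            ≡⟨ cong ((g ^ 3 + 1#) +_) (sym 2g²+2g≡0) ⟩
    (g ^ 3 + 1#) + ((g ^ 2 + g ^ 2) + (g + g))   ≡⟨ sym ([g+1][g²+g+1]≡g³+1+2g²+2g g) ⟩
    (g + 1#) * (p + 1#)                          ≡⟨ cong ((g + 1#) *_) p+1≡0 ⟩
    (g + 1#) * 0#                                ≡⟨ zeroʳ _ ⟩
    0#                                           ∎))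
    where
    open ≡-Reasoning
    [g+1][g²+g+1]≡g³+1+2g²+2g : ∀ g → (g + 1#) * ((g ^ 2 + g) + 1#) ≡ (g ^ 3 + 1#) + ((g ^ 2 + g ^ 2) + (g + g))
    [g+1][g²+g+1]≡g³+1+2g²+2g = solve 1 (λ g → (g :+ con 1) :* ((g :^ 2 :+ g) :+ con 1)
                                            := (g :^ 3 :+ con 1) :+ ((g :^ 2 :+ g :^ 2) :+ (g :+ g))) refl
    2g²+2g≡0 : (g ^ 2 + g ^ 2) + (g + g) ≡ 0#
    2g²+2g≡0 = trans (cong₂ _+_ (x+x≡0 (g ^ 2)) (x+x≡0 g)) (+-identityʳ 0#)

  r : Carrier
  r = p ^ 2 * (p + 1#)

  r≢0 : r ≢ 0#
  r≢0 = *-nonZero (^-nonZero 2 p≢0) p+1≢0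

  θ : Carrier → Carrier
  θ = traceMap p r

  θ-additive : Additive θ
  θ-additive = traceMap-additive p r

  θ-injective : Injective _≡_ _≡_ θ
  θ-injective = additive∧trivialKernel⇒injective θ-additive (traceMap-trivialKernel p≢0 pz≡1⇒tr[rz]≡0)
    where
    pz≡1⇒tr[rz]≡0 : ∀ {z} → p * z ≡ 1# → trace (r * z) ≡ 0#
    pz≡1⇒tr[rz]≡0 {z} pz≡1 = begin
      trace (r * z)                   ≡⟨ cong trace (r*z≡[p²+p]*[p*z] p z) ⟩
      trace ((p ^ 2 + p) * (p * z))   ≡⟨ cong (λ u → trace ((p ^ 2 + p) * u)) pz≡1 ⟩
      trace ((p ^ 2 + p) * 1#)        ≡⟨ cong trace (*-identityʳ _) ⟩
      trace (p ^ 2 + p)               ≡⟨ trace-[x²+x]≡0 p ⟩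
      0#                              ∎
      where
      open ≡-Reasoning
      r*z≡[p²+p]*[p*z] : ∀ p z → (p ^ 2 * (p + 1#)) * z ≡ (p ^ 2 + p) * (p * z)
      r*z≡[p²+p]*[p*z] = solve 2 (λ p z → (p :^ 2 :* (p :+ con 1)) :* z := (p :^ 2 :+ p) :* (p :* z)) refl

  θ-sub-id-injective : Injective _≡_ _≡_ (λ x → θ x - x)
  θ-sub-id-injective {x} {y} eq = [p+1]-injective (trans (sym (traceMap-sub-id p r x)) (trans eq (traceMap-sub-id p r y)))
    where
    [p+1]z≡1⇒tr[rz]≡0 : ∀ {z} → (p + 1#) * z ≡ 1# → trace (r * z) ≡ 0#
    [p+1]z≡1⇒tr[rz]≡0 {z} [p+1]z≡1 = begin
      trace (r * z)                    ≡⟨ cong trace (*-assoc (p ^ 2) (p + 1#) z) ⟩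
      trace (p ^ 2 * ((p + 1#) * z))   ≡⟨ cong (λ u → trace (p ^ 2 * u)) [p+1]z≡1 ⟩
      trace (p ^ 2 * 1#)               ≡⟨ cong trace (*-identityʳ _) ⟩
      trace (p ^ 2)                    ≡⟨ trace-^2 p ⟩
      trace (g ^ 2 + g)                ≡⟨ trace-[x²+x]≡0 g ⟩
      0#                               ∎
      where open ≡-Reasoning
    [p+1]-injective : Injective _≡_ _≡_ (traceMap (p + 1#) r)
    [p+1]-injective = additive∧trivialKernel⇒injective (traceMap-additive (p + 1#) r)
                        (traceMap-trivialKernel p+1≢0 [p+1]z≡1⇒tr[rz]≡0)

  θ-orthomorphism : IsOrthomorphism F θ
  θ-orthomorphism = injective⇒orthomorphism θ-injective θ-sub-id-injective

  θ-not-equivariant : ∀ ℓ .{{_ : NonZero ℓ}} → ℓ ℕ.< N → ¬ ScalingEquivariant (g ^ ℓ) θ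
  θ-not-equivariant ℓ ℓ<N θ-equivariant = gˡ≢1 gen ℓ ℓ<N (x²≡x⇒x≡1 (^-nonZero ℓ g≢0) (begin
    ζ ^ 2         ≡⟨ cong (_^ 2) (sym tr[ζ]≡ζ) ⟩
    trace ζ ^ 2   ≡⟨ trace-idempotent ζ ⟩
    trace ζ       ≡⟨ tr[ζ]≡ζ ⟩
    ζ             ∎))
    where
    open ≡-Reasoning
    ζ = g ^ ℓ
    r⁻¹ = proj₁ (inverse r r≢0)
    rr⁻¹≡1 : r * r⁻¹ ≡ 1#
    rr⁻¹≡1 = proj₂ (inverse r r≢0)
    r⁻¹≢0 : r⁻¹ ≢ 0#
    r⁻¹≢0 r⁻¹≡0 = 0≢1 (trans (sym (zeroʳ r)) (trans (cong (r *_) (sym r⁻¹≡0)) rr⁻¹≡1))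
    tr[ζ]≡ζ : trace ζ ≡ ζ
    tr[ζ]≡ζ = traceMap-equivariant⇒trace-fixed (partialTrace-odd-1 k) rr⁻¹≡1 (θ-equivariant r⁻¹≢0)

  irregular : Irregular F (suc N) g θ
  irregular = θ-orthomorphism , λ h →
    let Tθ≗θ = additive⇒translation-invariant θ-additive h in
    nonCyclotomic gen (orthomorphism-resp-≗ (sym ∘ Tθ≗θ) θ-orthomorphism)
                      (trans (Tθ≗θ 0#) (additive⇒0↦0 θ-additive))
                      (λ ℓ ℓ<N Tθ-equivariant → θ-not-equivariant ℓ ℓ<N (scalingEquivariant-resp-≗ Tθ≗θ Tθ-equivariant))

open import Data.Nat using (_+_; _*_; _^_; _≥_)

theorem3p5 : ∀ {c : Level} (k : ℕ) → k ≥ 1 → (F : Field c) → HasOrder F (2 ^ (2 * k + 1))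
               → (g : Field.Carrier F) → IsGenerator F g
               → ∃ λ (θ : Field.Carrier F → Field.Carrier F) → Irregular F (2 ^ (2 * k + 1)) g θ
theorem3p5 k k≥1 F hord g gen = θ , subst (λ q → Irregular F q g θ) 1+N≡q irregular
  where
  q = 2 ^ (2 * k + 1)
  N = ℕ.pred q
  1+N≡q : suc N ≡ q
  1+N≡q = ℕ.suc-pred q {{ℕ.m^n≢0 2 (2 * k + 1)}}
  q≡2^[1+2k] : q ≡ 2 ^ suc (k + k)
  q≡2^[1+2k] = cong (2 ^_) (trans (ℕ.+-comm (2 * k) 1) (cong (λ n → suc (k + n)) (ℕ.+-identityʳ k)))
  3<N : 3 ℕ.< N
  3<N = ℕ.≤-trans (ℕ.m≤m+n 4 3) (ℕ.∸-monoˡ-≤ 1 (ℕ.^-monoʳ-≤ 2 (ℕ.+-monoˡ-≤ 1 (ℕ.*-monoʳ-≤ 2 k≥1))))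
  open IrregularConstruction F N (subst (HasOrder F) (sym 1+N≡q) hord) gen k (trans 1+N≡q q≡2^[1+2k]) 3<N
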